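{- Let $n$ be a nonsquare positive integer. A successor of any step is reduced. Explicitly: for any positive integers $k,k',k'',m,m'$ such that $k<\sqrt n$, $kk'=|m^2-n|$, $k'k''=|m'^2-n|$ and $k'\mid m+m'$, if $$k'^2+\frac{k^2}{4}\le n\quad\text{and}\quad k''^2+\frac{k'^2}{4}\le n,$$ then $$k'^2+\frac{k''^2}{4}\le n.$$
   Context: Throughout, $n$ is a fixed nonsquare positive integer. A positive integer $m$ is best mod $k$ if for every positive integer $m'\equiv m\pmod k$, $|m^2-n|\le|m'^2-n|$. A step is a triple $(k,m,k')$ of positive integers with $k<\sqrt n$, $|m^2-n|=kk'$ and $m$ best mod $k$ (for such triples, $m$ best mod $k$ is equivalent to $k'^2+k^2/4\le n$). A step $(k,m,k')$ is reduced if moreover $m$ is best mod $k'$ (equivalently, $(k',m,k)$ is also a step, equivalently $k^2+k'^2/4\le n$). A successor of a step $(k,m,k')$ is a step $(k',m',k'')$ such that $m'\equiv -m\pmod{k'}$, $m'$ is best mod $k'$, and $k''=|m'^2-n|/k'$. -}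

module Defs where

open import Data.Nat using (ℕ; _*_; _<_)
open import Relation.Binary.PropositionalEquality using (_≢_)

NonSquare : ℕ → Set
NonSquare n = ∀ j → j * j ≢ n

-- k < √n  (for natural k, equivalent to k² < n since n is nonsquare; in fact k < √n ⇔ k² < n always)
BelowSqrt : ℕ → ℕ → Set
BelowSqrt k n = k * k < n

module Submission where

-- Everything is done over ℤ.  The hypothesis k·k′ = |m² − n| is read as a signed
-- cofactor: m² = n + B·k′ with B = ±k; likewise m′² = n + A·k′ with A = ±k″.
-- 1. Criterion.  From m² = n + B·k′ and B² = k² one gets the identity
--    4n + (2k′ + B)² = (4k′² + k²) + (2m)², so the quarter bound 4k′² + k² ≤ 4n
--    amounts to 2k′ + B ≤ 2m (for non-negative 2m, resp. 2k′ + B).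
-- 2. If k′ ≤ k″, the goal 4k′² + k″² ≤ 4n follows from 4k″² + k′² ≤ 4n.
-- 3. Otherwise |A| < k′.  Write m + m′ = (t + 1)·k′.  Eliminating m (and cancelling
--    k′) turns 2k′ + B ≤ 2m into (t² + 1)·k′ + A ≤ 2t·m′.  For t = 0 this contradicts
--    A > −k′; for t ≥ 1 the identity t(2k′ + A) + (t − 1)((t − 1)k′ − A) = (t² + 1)k′ + A
--    gives 2k′ + A ≤ 2m′, which by the criterion read backwards is the goal.

open import Data.Nat as ℕ using (ℕ; zero; suc; z≤n)
import Data.Nat.Properties as ℕₚ
open import Data.Product using (_×_; _,_)
open import Data.Sum using (_⊎_; inj₁; inj₂)
open import Data.List using (_∷_; [])
open import Relation.Nullary using (yes; no; contradiction)
open import Relation.Binary.PropositionalEquality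
  using (_≡_; refl; sym; trans; cong; cong₂; subst; subst₂; module ≡-Reasoning)

module IntegerArithmetic where

  open import Data.Integer
    using (ℤ; +_; -_; -[1+_]; 0ℤ; _+_; _-_; _*_; _≤_; _<_; +≤+; -≤+; >-nonZero)
  open import Data.Integer.Properties
    using ( ≤-refl; ≤-trans; <⇒≤; <⇒≱; ≰⇒>; ≤-<-trans; <-≤-trans; _≤?_; drop‿+≤+
          ; neg-mono-≤; neg-mono-<; +-comm; +-identityˡ; +-mono-≤; +-monoʳ-≤; *-monoˡ-≤-nonNeg
          ; *-cancelˡ-≡; *-cancelˡ-≤-pos; i≤j⇒0≤j-i; pos-+; pos-*; neg-distribˡ-*
          ; module ≤-Reasoning)
  open import Data.Integer.Tactic.RingSolver using (solve; solve-∀)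

  trade : ∀ {a b x y} → a + x ≡ b + y → b ≤ a → x ≤ y
  trade {a} {b} {x} {y} eq b≤a = begin
    x             ≡⟨ solve (a ∷ x ∷ []) ⟩
    (a + x) - a   ≡⟨ cong (_- a) eq ⟩
    (b + y) - a   ≤⟨ +-monoʳ-≤ (b + y) (neg-mono-≤ b≤a) ⟩
    (b + y) - b   ≡⟨ solve (b ∷ y ∷ []) ⟩
    y             ∎
    where open ≤-Reasoning

  trade′ : ∀ {a b x y} → a + x ≡ b + y → x ≤ y → b ≤ a
  trade′ {a} {b} {x} {y} eq = trade {y} {x} {b} {a} (trans (+-comm y b) (trans (sym eq) (+-comm a x)))

  i≤i+nonNeg : ∀ {a x} → 0ℤ ≤ x → a ≤ a + x
  i≤i+nonNeg {a} {x} 0≤x = trade (trans (+-comm x a) (sym (+-identityˡ (a + x)))) 0≤x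

  sub-eq : ∀ {x y z} → z ≡ x + y → x ≡ z - y
  sub-eq {x} {y} refl = solve (x ∷ y ∷ [])

  nonNeg-* : ∀ {a b} → 0ℤ ≤ a → 0ℤ ≤ b → 0ℤ ≤ a * b
  nonNeg-* {+ x} {+ y} (+≤+ _) (+≤+ _) = subst (0ℤ ≤_) (pos-* x y) (+≤+ z≤n)

  square-mono : ∀ {a b} → 0ℤ ≤ a → a ≤ b → a * a ≤ b * b
  square-mono {+ x} {+ y} (+≤+ _) (+≤+ x≤y) =
    subst₂ _≤_ (pos-* x x) (pos-* y y) (+≤+ (ℕₚ.*-mono-≤ x≤y x≤y))

  square-cancel : ∀ {a b} → 0ℤ ≤ b → a * a ≤ b * b → a ≤ b
  square-cancel { -[1+ x ]} (+≤+ _) _ = -≤+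
  square-cancel {+ x} {+ y} (+≤+ _) xx≤yy with x ℕ.≤? y
  ... | yes x≤y = +≤+ x≤y
  ... | no x≰y = contradiction xx≤yyₙ (ℕₚ.<⇒≱ (ℕₚ.*-mono-< y<x y<x))
    where
    y<x : y ℕ.< x
    y<x = ℕₚ.≰⇒> x≰y
    xx≤yyₙ : x ℕ.* x ℕ.≤ y ℕ.* y
    xx≤yyₙ = drop‿+≤+ (subst₂ _≤_ (sym (pos-* x x)) (sym (pos-* y y)) xx≤yy)

  -- The quarter bound 4X² + Y² ≤ 4N, i.e. X² + Y²/4 ≤ N: for a step (k, m, k′) it
  -- says that m is best mod k (X = k′, Y = k), and reducedness is the bound with X = k.
  QuarterBound : ℤ → ℤ → ℤ → Set
  QuarterBound N X Y = + 4 * (X * X) + Y * Y ≤ + 4 * N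

  -- For 0 ≤ X ≤ Y we have 4X² + Y² ≤ 4Y² + X², so the bound for (Y, X) implies the one for (X, Y).
  quarterBound-swap : ∀ {N X Y} → 0ℤ ≤ X → X ≤ Y → QuarterBound N Y X → QuarterBound N X Y
  quarterBound-swap {N} {X} {Y} 0≤X X≤Y bound = ≤-trans smaller bound
    where
    smaller : + 4 * (X * X) + Y * Y ≤ + 4 * (Y * Y) + X * X
    smaller = trade rearrange (*-monoˡ-≤-nonNeg (+ 3) (square-mono 0≤X X≤Y))
      where
      rearrange : + 3 * (Y * Y) + (+ 4 * (X * X) + Y * Y) ≡ + 3 * (X * X) + (+ 4 * (Y * Y) + X * X)
      rearrange = solve (X ∷ Y ∷ [])

  -- A signed cofactor of M² − N along K′: M² = N + B·K′ with B = ±K.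
  -- This is the integer reading of K·K′ = |M² − N|.
  record Cofactor (N M K K′ : ℤ) : Set where
    field
      cof    : ℤ
      cof-eq : M * M ≡ N + cof * K′
      cof-±  : cof ≡ K ⊎ cof ≡ - K
  open Cofactor

  ±-square : ∀ {B K} → B ≡ K ⊎ B ≡ - K → B * B ≡ K * K
  ±-square (inj₁ refl) = refl
  ±-square {K = K} (inj₂ refl) = solve (K ∷ [])

  gap-identity : ∀ {N M K K′ B} → M * M ≡ N + B * K′ → B * B ≡ K * K →
    + 4 * N + (+ 2 * K′ + B) * (+ 2 * K′ + B) ≡ (+ 4 * (K′ * K′) + K * K) + (+ 2 * M) * (+ 2 * M)
  gap-identity {N} {M} {K} {K′} {B} eqM eqB = begin
    + 4 * N + (+ 2 * K′ + B) * (+ 2 * K′ + B)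
      ≡⟨ solve (N ∷ K′ ∷ B ∷ []) ⟩
    + 4 * (N + B * K′) + + 4 * (K′ * K′) + B * B
      ≡⟨ cong₂ (λ u v → + 4 * u + + 4 * (K′ * K′) + v) (sym eqM) eqB ⟩
    + 4 * (M * M) + + 4 * (K′ * K′) + K * K
      ≡⟨ solve (M ∷ K′ ∷ K ∷ []) ⟩
    (+ 4 * (K′ * K′) + K * K) + (+ 2 * M) * (+ 2 * M) ∎
    where open ≡-Reasoning

  cof-gap : ∀ {N M K K′} (c : Cofactor N M K K′) →
    + 4 * N + (+ 2 * K′ + cof c) * (+ 2 * K′ + cof c) ≡ (+ 4 * (K′ * K′) + K * K) + (+ 2 * M) * (+ 2 * M)
  cof-gap {N} {M} {K} {K′} c = gap-identity {N} {M} {K} {K′} {cof c} (cof-eq c) (±-square (cof-± c))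

  bound⇒cof-≤ : ∀ {N M K K′} (c : Cofactor N M K K′) → 0ℤ ≤ M →
    QuarterBound N K′ K → + 2 * K′ + cof c ≤ + 2 * M
  bound⇒cof-≤ c 0≤M bound =
    square-cancel (*-monoˡ-≤-nonNeg (+ 2) 0≤M) (trade (cof-gap c) bound)

  cof-≤⇒bound : ∀ {N M K K′} (c : Cofactor N M K K′) → 0ℤ ≤ + 2 * K′ + cof c →
    + 2 * K′ + cof c ≤ + 2 * M → QuarterBound N K′ K
  cof-≤⇒bound c 0≤Q Q≤2M = trade′ (cof-gap c) (square-mono 0≤Q Q≤2M)

  -- For a successor, M = (1 + T)K′ − M′.  Eliminating M and cancelling K′ relates the
  -- bound 2K′ + B ≤ 2M for the first cofactor to a bound involving the second one, A.
  successor-identity : ∀ {N M M′ K′ A B} T → 0ℤ < K′ →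
    M * M ≡ N + B * K′ → M′ * M′ ≡ N + A * K′ → M ≡ (+ 1 + T) * K′ - M′ →
    + 2 * M + ((T * T + + 1) * K′ + A) ≡ (+ 2 * K′ + B) + + 2 * T * M′
  successor-identity {N} {M′ = M′} {K′} {A} {B} T 0<K′ eqB eqA refl =
    *-cancelˡ-≡ K′ _ _ {{>-nonZero 0<K′}} (begin
      K′ * (+ 2 * M + ((T * T + + 1) * K′ + A))
        ≡⟨ eliminate K′ T M′ A B N ⟩
      K′ * RHS + ((M * M - (N + B * K′)) - (M′ * M′ - (N + A * K′)))
        ≡⟨ cong₂ (λ u v → K′ * RHS + ((u - (N + B * K′)) - (v - (N + A * K′)))) eqB eqA ⟩
      K′ * RHS + (((N + B * K′) - (N + B * K′)) - ((N + A * K′) - (N + A * K′)))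
        ≡⟨ drop-zero (K′ * RHS) (N + B * K′) (N + A * K′) ⟩
      K′ * RHS ∎)
    where
    open ≡-Reasoning
    M RHS : ℤ
    M = (+ 1 + T) * K′ - M′
    RHS = (+ 2 * K′ + B) + + 2 * T * M′
    eliminate : ∀ K′ T M′ A B N →
      K′ * (+ 2 * ((+ 1 + T) * K′ - M′) + ((T * T + + 1) * K′ + A))
        ≡ K′ * ((+ 2 * K′ + B) + + 2 * T * M′)
          + ((((+ 1 + T) * K′ - M′) * ((+ 1 + T) * K′ - M′) - (N + B * K′)) - (M′ * M′ - (N + A * K′)))
    eliminate = solve-∀
    drop-zero : ∀ x p q → x + ((p - p) - (q - q)) ≡ x
    drop-zero = solve-∀

  -- The slack (t − 1)((t − 1)K′ − A) of the identity in step 3 is non-negative; here u = t − 1.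
  slack : ∀ {K′ A} (u : ℕ) → 0ℤ ≤ K′ → A < K′ → 0ℤ ≤ + u * (+ u * K′ - A)
  slack zero _ _ = ≤-refl
  slack {K′} {A} (suc v) 0≤K′ A<K′ =
    nonNeg-* {+ suc v} {+ suc v * K′ - A} (+≤+ z≤n) (subst (0ℤ ≤_) (regroup (+ v) K′ A) sum≥0)
    where
    sum≥0 : 0ℤ ≤ + v * K′ + (K′ - A)
    sum≥0 = +-mono-≤ (nonNeg-* {+ v} {K′} (+≤+ z≤n) 0≤K′) (i≤j⇒0≤j-i (<⇒≤ A<K′))
    regroup : ∀ V K′ A → V * K′ + (K′ - A) ≡ (+ 1 + V) * K′ - A
    regroup = solve-∀

  successor-bound : ∀ {K′ A M′} (t : ℕ) → 0ℤ ≤ K′ → - K′ < A → A < K′ →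
    (+ t * + t + + 1) * K′ + A ≤ + 2 * + t * M′ → + 2 * K′ + A ≤ + 2 * M′
  successor-bound {K′} {A} {M′} zero _ -K′<A _ bound =
    contradiction (trade (at-zero K′ A M′) bound) (<⇒≱ -K′<A)
    where
    -- For t = 0 the bound reads K′ + A ≤ 0, i.e. A ≤ −K′.
    at-zero : ∀ K′ A M′ → + 2 * + 0 * M′ + A ≡ ((+ 0 * + 0 + + 1) * K′ + A) + - K′
    at-zero = solve-∀
  successor-bound {K′} {A} {M′} (suc u) 0≤K′ _ A<K′ bound =
    *-cancelˡ-≤-pos (+ 2 * K′ + A) (+ 2 * M′) (+ suc u) (begin
      T * (+ 2 * K′ + A)                            ≤⟨ i≤i+nonNeg (slack u 0≤K′ A<K′) ⟩
      T * (+ 2 * K′ + A) + U * (U * K′ - A)         ≡⟨ expand U K′ A ⟩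
      (T * T + + 1) * K′ + A                        ≤⟨ bound ⟩
      + 2 * T * M′                                  ≡⟨ reorder T M′ ⟩
      T * (+ 2 * M′)                                ∎)
    where
    open ≤-Reasoning
    U T : ℤ
    U = + u
    T = + 1 + U
    expand : ∀ U K′ A → (+ 1 + U) * (+ 2 * K′ + A) + U * (U * K′ - A) ≡ ((+ 1 + U) * (+ 1 + U) + + 1) * K′ + A
    expand = solve-∀
    reorder : ∀ T M′ → + 2 * T * M′ ≡ T * (+ 2 * M′)
    reorder = solve-∀

  neg≤self : ∀ {K} → 0ℤ ≤ K → - K ≤ K
  neg≤self 0≤K = ≤-trans (neg-mono-≤ 0≤K) 0≤K

  ±-bounded : ∀ {A K″ K′} → A ≡ K″ ⊎ A ≡ - K″ → 0ℤ ≤ K″ → K″ < K′ → - K′ < A × A < K′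
  ±-bounded (inj₁ refl) 0≤K″ K″<K′ = <-≤-trans (neg-mono-< K″<K′) (neg≤self 0≤K″) , K″<K′
  ±-bounded (inj₂ refl) 0≤K″ K″<K′ = neg-mono-< K″<K′ , ≤-<-trans (neg≤self 0≤K″) K″<K′

  nonNeg-2K′+A : ∀ {K′ A} → 0ℤ ≤ K′ → - K′ < A → 0ℤ ≤ + 2 * K′ + A
  nonNeg-2K′+A {K′} {A} 0≤K′ -K′<A =
    ≤-trans 0≤K′ (trade {A} { - K′} {K′} {+ 2 * K′ + A} (rearrange K′ A) (<⇒≤ -K′<A))
    where
    rearrange : ∀ K′ A → A + K′ ≡ - K′ + (+ 2 * K′ + A)
    rearrange = solve-∀

  successor-reduced : ∀ {N K K′ K″ M M′} (t : ℕ) → 0ℤ < K′ → 0ℤ ≤ K″ → 0ℤ ≤ M →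
    (c : Cofactor N M K K′) (c′ : Cofactor N M′ K″ K′) → M + M′ ≡ (+ 1 + + t) * K′ →
    QuarterBound N K′ K → QuarterBound N K″ K′ → QuarterBound N K′ K″
  successor-reduced {N} {K} {K′} {K″} {M} {M′} t 0<K′ 0≤K″ 0≤M c c′ sum bound bound′ with K′ ≤? K″
  ... | yes K′≤K″ = quarterBound-swap (<⇒≤ 0<K′) K′≤K″ bound′
  ... | no K′≰K″ with ±-bounded (cof-± c′) 0≤K″ (≰⇒> K′≰K″)
  ... | -K′<A , A<K′ =
    cof-≤⇒bound c′ (nonNeg-2K′+A 0≤K′ -K′<A) (successor-bound t 0≤K′ -K′<A A<K′ shifted)
    where
    A : ℤ
    A = cof c′
    0≤K′ : 0ℤ ≤ K′
    0≤K′ = <⇒≤ 0<K′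
    -- Step 3: the forward criterion for the first cofactor, moved to the second one.
    shifted : (+ t * + t + + 1) * K′ + A ≤ + 2 * + t * M′
    shifted = trade (successor-identity {N} {M} {M′} {K′} {A} {cof c} (+ t) 0<K′ (cof-eq c) (cof-eq c′)
                      (sub-eq (sym sum)))
                    (bound⇒cof-≤ c 0≤M bound)

  ∣-∣-cases : ∀ a n → a ≡ n ℕ.+ ℕ.∣ a - n ∣ ⊎ n ≡ a ℕ.+ ℕ.∣ a - n ∣
  ∣-∣-cases a n with ℕₚ.≤-total a n
  ... | inj₁ a≤n = inj₂ (trans (sym (ℕₚ.m+[n∸m]≡n a≤n)) (cong (a ℕ.+_) (sym (ℕₚ.m≤n⇒∣m-n∣≡n∸m a≤n))))
  ... | inj₂ n≤a = inj₁ (trans (sym (ℕₚ.m+[n∸m]≡n n≤a)) (cong (n ℕ.+_) (sym (ℕₚ.m≤n⇒∣n-m∣≡n∸m n≤a))))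

  pos-+* : ∀ a b c → + (a ℕ.+ b ℕ.* c) ≡ + a + + b * + c
  pos-+* a b c = trans (pos-+ a (b ℕ.* c)) (cong (λ u → + a + u) (pos-* b c))

  cofactor : ∀ n m k k′ → k ℕ.* k′ ≡ ℕ.∣ m ℕ.* m - n ∣ → Cofactor (+ n) (+ m) (+ k) (+ k′)
  cofactor n m k k′ eq with ∣-∣-cases (m ℕ.* m) n
  ... | inj₁ above = record { cof = + k ; cof-eq = square-above ; cof-± = inj₁ refl }
    where
    square-above : + m * + m ≡ + n + + k * + k′
    square-above = trans (sym (pos-* m m))
      (trans (cong +_ (trans above (cong (n ℕ.+_) (sym eq)))) (pos-+* n k k′))
  ... | inj₂ below = record { cof = - + k ; cof-eq = square-below ; cof-± = inj₂ refl }
    where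
    n-as-sum : + n ≡ + m * + m + + k * + k′
    n-as-sum = trans (cong +_ (trans below (cong (m ℕ.* m ℕ.+_) (sym eq))))
      (trans (pos-+* (m ℕ.* m) k k′) (cong (_+ + k * + k′) (pos-* m m)))
    square-below : + m * + m ≡ + n + - + k * + k′
    square-below = trans (sub-eq n-as-sum) (cong (λ u → + n + u) (neg-distribˡ-* (+ k) (+ k′)))

  sum-cast : ∀ m m′ q k′ → m ℕ.+ m′ ≡ q ℕ.* k′ → + m + + m′ ≡ + q * + k′
  sum-cast m m′ q k′ eq = trans (sym (pos-+ m m′)) (trans (cong +_ eq) (pos-* q k′))

  quarterBound-cast : ∀ x y → + (4 ℕ.* (x ℕ.* x) ℕ.+ y ℕ.* y) ≡ + 4 * (+ x * + x) + + y * + y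
  quarterBound-cast x y = trans (pos-+ (4 ℕ.* (x ℕ.* x)) (y ℕ.* y))
    (cong₂ _+_ (trans (pos-* 4 (x ℕ.* x)) (cong (+ 4 *_) (pos-* x x))) (pos-* y y))

  quarterBound-toℤ : ∀ n x y → 4 ℕ.* (x ℕ.* x) ℕ.+ y ℕ.* y ℕ.≤ 4 ℕ.* n → QuarterBound (+ n) (+ x) (+ y)
  quarterBound-toℤ n x y h = subst₂ _≤_ (quarterBound-cast x y) (pos-* 4 n) (+≤+ h)

  quarterBound-fromℤ : ∀ n x y → QuarterBound (+ n) (+ x) (+ y) → 4 ℕ.* (x ℕ.* x) ℕ.+ y ℕ.* y ℕ.≤ 4 ℕ.* n
  quarterBound-fromℤ n x y h = drop‿+≤+ (subst₂ _≤_ (sym (quarterBound-cast x y)) (sym (pos-* 4 n)) h)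

open IntegerArithmetic
open import Defs
open import Data.Nat using (_+_; _*_; _≤_; ∣_-_∣; NonZero)
open import Data.Nat.Divisibility using (_∣_; divides)
open import Data.Integer using (0ℤ; +_; +≤+; +<+) renaming (_<_ to _<ℤ_)

theorem1 : (n : ℕ) → NonZero n → NonSquare n →
           (k k′ k″ m m′ : ℕ) →
           NonZero k → NonZero k′ → NonZero k″ → NonZero m → NonZero m′ →
           BelowSqrt k n →
           k * k′ ≡ ∣ m * m - n ∣ →
           k′ * k″ ≡ ∣ m′ * m′ - n ∣ →
           k′ ∣ m + m′ →
           4 * (k′ * k′) + k * k ≤ 4 * n →
           4 * (k″ * k″) + k′ * k′ ≤ 4 * n →
           4 * (k′ * k′) + k″ * k″ ≤ 4 * n
-- m + m′ = 0 is impossible since m ≠ 0.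
theorem1 n _ _ k k′ k″ m m′ _ _ _ m≢0 _ _ _ _ (divides zero sum) _ _ =
  contradiction (ℕₚ.m+n≡0⇒m≡0 m sum) (ℕ.≢-nonZero⁻¹ m {{m≢0}})
theorem1 n _ _ k k′ k″ m m′ _ k′≢0 _ _ _ _ step step′ (divides (suc t) sum) bound bound′ =
  quarterBound-fromℤ n k′ k″ (successor-reduced t 0<k′ (+≤+ z≤n) (+≤+ z≤n)
    (cofactor n m k k′ step) (cofactor n m′ k″ k′ (trans (ℕₚ.*-comm k″ k′) step′))
    (sum-cast m m′ (suc t) k′ sum)
    (quarterBound-toℤ n k′ k bound) (quarterBound-toℤ n k″ k′ bound′))
  where
  0<k′ : 0ℤ <ℤ + k′
  0<k′ = +<+ (ℕ.>-nonZero⁻¹ k′ {{k′≢0}})
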